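{- Let $G$ be a labeled graph and $\mathcal H$ a finite multiset of standard components of $G$. Then $\mathcal H$ can be extended to a standard decomposition of $G$ (i.e. there is a standard decomposition of $G$ containing $\mathcal H$ as a submultiset) if and only if $G\ominus\sum\mathcal H$ is standard. In particular, every standard graph admits a standard decomposition.
   Context: A labeled graph $G$: finite node set $V(G)$, directed edges $E(G)\subseteq V(G)\times V(G)$ without loops, labeling $\ell_G\colon V(G)\to\mathbb{Z}$. $G$ is standard if all labels are $\ge0$ and $\ell_G(a)\le\ell_G(b)$ for each edge $(a,b)$. For graphs with the same nodes and edges, $\oplus$ and $\ominus$ add and subtract labels nodewise; $\sum\mathcal H$ is the sum of the elements of a multiset (zero labeling if empty). A standard component of $G$ is a labeled graph $H$ with the same nodes and edges as $G$, all labels in $\{0,1\}$, such that $H$ is standard, $G\ominus H$ is standard, and not all labels of $H$ are zero. A standard decomposition of $G$ is a finite multiset of standard components of $G$ whose sum is $G$. -}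

module Defs where

open import Data.Nat using (ℕ)
open import Data.Fin using (Fin)
open import Data.Integer using (ℤ; _+_; _-_; _≤_; 0ℤ; 1ℤ)
open import Data.List using (List; foldr)
open import Data.List.Membership.Propositional using (_∈_)
open import Data.List.Relation.Unary.All using (All)
open import Data.List.Relation.Binary.Permutation.Propositional using (_↭_)
open import Data.Product using (_×_; _,_; Σ; ∃)
open import Data.Sum using (_⊎_)
open import Relation.Binary.PropositionalEquality using (_≡_; _≢_)
open import Relation.Nullary using (¬_)

-- The unlabeled part of a labeled graph: node set Fin n, a finite set of
-- directed edges (given as a list; duplicates are harmless) without loops.
record Skeleton : Set where
  field
    n        : ℕ
    edges    : List (Fin n × Fin n)
    loopless : All (λ e → Data.Product.proj₁ e ≢ Data.Product.proj₂ e) edges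
open Skeleton public

Labeling : Skeleton → Set
Labeling S = Fin (n S) → ℤ

_⊕_ : ∀ {S} → Labeling S → Labeling S → Labeling S
(f ⊕ g) v = f v + g v

_⊖_ : ∀ {S} → Labeling S → Labeling S → Labeling S
(f ⊖ g) v = f v - g v

zeroL : ∀ {S} → Labeling S
zeroL v = 0ℤ

-- sum of a (finite) multiset of labeled graphs, represented as a list
ΣL : ∀ {S} → List (Labeling S) → Labeling S
ΣL {S} = foldr (_⊕_ {S}) (zeroL {S})

Standard : (S : Skeleton) → Labeling S → Set
Standard S ℓ = (∀ v → 0ℤ ≤ ℓ v)
             × (∀ a b → (a , b) ∈ edges S → ℓ a ≤ ℓ b)

StdComponent : (S : Skeleton) → Labeling S → Labeling S → Set
StdComponent S ℓ h = (∀ v → h v ≡ 0ℤ ⊎ h v ≡ 1ℤ)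
                   × Standard S h
                   × Standard S (_⊖_ {S} ℓ h)
                   × ¬ (∀ v → h v ≡ 0ℤ)

StdDecomposition : (S : Skeleton) → Labeling S → List (Labeling S) → Set
StdDecomposition S ℓ D = All (StdComponent S ℓ) D × (∀ v → ΣL {S} D v ≡ ℓ v)

_⊆ₘ_ : {A : Set} → List A → List A → Set
H ⊆ₘ D = ∃ λ R → D ↭ Data.List._++_ H R

module Submission where

-- A standard labeling ℓ with values in 0 … M (M the largest
-- label) is the sum of its M level sets: the k-th level is the 0/1 labeling
-- that is 1 exactly at the nodes with ℓ v > k.  Each level is a standard
-- component: it is monotone along edges because ℓ is, the remainder
-- ℓ ⊖ level k is again monotone, and for k < M some node lies above k.
-- Summing the levels for k < M gives M ⊓ ℓ v = ℓ v at every node.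
--
-- If D ↭ H ++ R is a standard decomposition then
-- ℓ ⊖ ΣH = ΣR is a sum of standard labelings, hence standard.  Conversely,
-- if ℓ ⊖ ΣH is standard, decompose it by the existence result; every
-- standard component of ℓ ⊖ ΣH is one of ℓ (add back the standard ΣH), so
-- H ++ D' is a standard decomposition of ℓ containing H.

open import Defs
open import Data.Nat as ℕ using (ℕ; zero; suc; z≤n; s≤s; _⊓_)
import Data.Nat.Properties as ℕP
open import Data.Integer as ℤ using (ℤ; +_; ∣_∣; +≤+; 0ℤ; 1ℤ)
import Data.Integer.Properties as ℤP
open import Data.Integer.Solver using (module +-*-Solver)
open import Data.Fin using (Fin)
open import Data.List using (List; []; _∷_; _++_; tabulate)
open import Data.List.Membership.Propositional using (_∈_)
open import Data.List.Extrema.Nat using (max; xs≤max; max≤v⁺)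
open import Data.List.Relation.Unary.All as All using (All; []; _∷_)
import Data.List.Relation.Unary.All.Properties as AllP
open import Data.List.Relation.Binary.Permutation.Propositional
  using (_↭_; ↭-refl; refl; prep; swap; trans)
open import Data.List.Relation.Binary.Permutation.Propositional.Properties
  using (All-resp-↭)
open import Data.Product using (_×_; ∃; _,_; proj₁; proj₂)
open import Data.Sum using (_⊎_; inj₁; inj₂)
open import Function.Bundles using (_⇔_; mk⇔)
open import Relation.Nullary using (¬_)
open import Relation.Binary.PropositionalEquality as ≡
  using (_≡_; _≗_; cong; cong₂; subst; subst₂)
open ≡.≡-Reasoning

module _ where
  open +-*-Solver

  sum-minus-left : ∀ a b c → a ℤ.+ b ≡ c → c ℤ.- a ≡ b
  sum-minus-left a b _ ≡.refl = solve 2 (λ a b → (a :+ b) :- a := b) ≡.refl a b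

  plus-difference : ∀ l s → s ℤ.+ (l ℤ.- s) ≡ l
  plus-difference = solve 2 (λ l s → s :+ (l :- s) := l) ≡.refl

  difference-shift : ∀ l s h → (l ℤ.- s) ℤ.- h ℤ.+ s ≡ l ℤ.- h
  difference-shift = solve 3 (λ l s h → (l :- s) :- h :+ s := l :- h) ≡.refl

module _ (S : Skeleton) where

  Standard-resp : ∀ {f g : Labeling S} → f ≗ g → Standard S f → Standard S g
  Standard-resp f≗g (nonneg , mono) =
    (λ v → subst (0ℤ ℤ.≤_) (f≗g v) (nonneg v)) ,
    (λ a b ab → subst₂ ℤ._≤_ (f≗g a) (f≗g b) (mono a b ab))

  Standard-zero : Standard S (zeroL {S})
  Standard-zero = (λ _ → +≤+ z≤n) , (λ _ _ _ → +≤+ z≤n)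

  Standard-⊕ : ∀ {f g : Labeling S} → Standard S f → Standard S g → Standard S (_⊕_ {S} f g)
  Standard-⊕ (nonneg , mono) (nonneg′ , mono′) =
    (λ v → ℤP.+-mono-≤ (nonneg v) (nonneg′ v)) ,
    (λ a b ab → ℤP.+-mono-≤ (mono a b ab) (mono′ a b ab))

  Standard-Σ : ∀ {xs : List (Labeling S)} → All (Standard S) xs → Standard S (ΣL {S} xs)
  Standard-Σ []       = Standard-zero
  Standard-Σ (p ∷ ps) = Standard-⊕ p (Standard-Σ ps)

  Σ-++ : ∀ (xs ys : List (Labeling S)) → ΣL {S} (xs ++ ys) ≗ _⊕_ {S} (ΣL {S} xs) (ΣL {S} ys)
  Σ-++ []       ys v = ≡.sym (ℤP.+-identityˡ _)
  Σ-++ (x ∷ xs) ys v = begin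
    x v ℤ.+ ΣL {S} (xs ++ ys) v                  ≡⟨ cong (λ s → x v ℤ.+ s) (Σ-++ xs ys v) ⟩
    x v ℤ.+ (ΣL {S} xs v ℤ.+ ΣL {S} ys v)        ≡⟨ ℤP.+-assoc (x v) _ _ ⟨
    x v ℤ.+ ΣL {S} xs v ℤ.+ ΣL {S} ys v          ∎

  Σ-↭ : ∀ {xs ys : List (Labeling S)} → xs ↭ ys → ΣL {S} xs ≗ ΣL {S} ys
  Σ-↭ refl            v = ≡.refl
  Σ-↭ (prep x p)      v = cong (λ s → x v ℤ.+ s) (Σ-↭ p v)
  Σ-↭ (swap {xs} {ys} x y p) v = begin
    x v ℤ.+ (y v ℤ.+ ΣL {S} xs v)  ≡⟨ ℤP.+-assoc (x v) _ _ ⟨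
    x v ℤ.+ y v ℤ.+ ΣL {S} xs v    ≡⟨ cong₂ ℤ._+_ (ℤP.+-comm (x v) (y v)) (Σ-↭ p v) ⟩
    y v ℤ.+ x v ℤ.+ ΣL {S} ys v    ≡⟨ ℤP.+-assoc (y v) _ _ ⟩
    y v ℤ.+ (x v ℤ.+ ΣL {S} ys v)  ∎
  Σ-↭ (trans p q)     v = ≡.trans (Σ-↭ p v) (Σ-↭ q v)

  components-standard : ∀ {ℓ} {xs : List (Labeling S)} →
    All (StdComponent S ℓ) xs → All (Standard S) xs
  components-standard = All.map (λ c → proj₁ (proj₂ c))

  -- Removing a standard labeling K from ℓ only shrinks the set of
  -- standard components: a component h of ℓ ⊖ K is one of ℓ, because
  -- ℓ ⊖ h = ((ℓ ⊖ K) ⊖ h) ⊕ K is a sum of standard labelings.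
  component-lift : ∀ {ℓ K h : Labeling S} → Standard S K →
    StdComponent S (_⊖_ {S} ℓ K) h → StdComponent S ℓ h
  component-lift {ℓ} {K} {h} stdK (zero-one , stdh , rest , nonzero) =
    zero-one , stdh ,
    Standard-resp (λ v → difference-shift (ℓ v) (K v) (h v)) (Standard-⊕ rest stdK) ,
    nonzero

-- Level indicators on ℕ: above k m is 1 if k < m and 0 otherwise, and
-- lower k m = m ∸ above k m is what remains after removing level k.
above : ℕ → ℕ → ℕ
above k       zero    = 0
above zero    (suc m) = 1
above (suc k) (suc m) = above k m

lower : ℕ → ℕ → ℕ
lower k       zero    = 0
lower zero    (suc m) = m
lower (suc k) (suc m) = suc (lower k m)

above-0-or-1 : ∀ k m → above k m ≡ 0 ⊎ above k m ≡ 1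
above-0-or-1 k       zero    = inj₁ ≡.refl
above-0-or-1 zero    (suc m) = inj₂ ≡.refl
above-0-or-1 (suc k) (suc m) = above-0-or-1 k m

above+lower : ∀ k m → above k m ℕ.+ lower k m ≡ m
above+lower k       zero    = ≡.refl
above+lower zero    (suc m) = ≡.refl
above+lower (suc k) (suc m) = ≡.trans (ℕP.+-suc (above k m) _) (cong suc (above+lower k m))

above-mono : ∀ k {a b} → a ℕ.≤ b → above k a ℕ.≤ above k b
above-mono k       {zero}  _         = z≤n
above-mono zero    {suc a} (s≤s _)   = s≤s z≤n
above-mono (suc k) {suc a} (s≤s a≤b) = above-mono k a≤b

lower-mono : ∀ k {a b} → a ℕ.≤ b → lower k a ℕ.≤ lower k b
lower-mono k       {zero}  _         = z≤n
lower-mono zero    {suc a} (s≤s a≤b) = a≤b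
lower-mono (suc k) {suc a} (s≤s a≤b) = s≤s (lower-mono k a≤b)

above≡0⇒≤ : ∀ k m → above k m ≡ 0 → m ℕ.≤ k
above≡0⇒≤ k       zero    _  = z≤n
above≡0⇒≤ (suc k) (suc m) eq = s≤s (above≡0⇒≤ k m eq)

-- Adding level N to the sum of the levels below it: N ⊓ m grows by above N m.
above-step : ∀ N m → above N m ℕ.+ N ⊓ m ≡ suc N ⊓ m
above-step N       zero    = ℕP.⊓-zeroʳ N
above-step zero    (suc m) = ≡.refl
above-step (suc N) (suc m) = ≡.trans (ℕP.+-suc (above N m) _) (cong suc (above-step N m))

module LevelDecomposition (S : Skeleton) (ℓ : Labeling S) (std : Standard S ℓ) where

  lab : Fin (n S) → ℕ
  lab v = ∣ ℓ v ∣

  lab-correct : ∀ v → + lab v ≡ ℓ v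
  lab-correct v = ℤP.0≤i⇒+∣i∣≡i (proj₁ std v)

  lab-mono : ∀ a b → (a , b) ∈ edges S → lab a ℕ.≤ lab b
  lab-mono a b ab with subst₂ ℤ._≤_ (≡.sym (lab-correct a)) (≡.sym (lab-correct b)) (proj₂ std a b ab)
  ... | +≤+ a≤b = a≤b

  height : ℕ
  height = max 0 (tabulate lab)

  lab≤height : ∀ v → lab v ℕ.≤ height
  lab≤height = AllP.tabulate⁻ (xs≤max 0 (tabulate lab))

  height-least : ∀ {k} → (∀ v → lab v ℕ.≤ k) → height ℕ.≤ k
  height-least bound = max≤v⁺ z≤n (AllP.tabulate⁺ bound)

  level : ℕ → Labeling S
  level k v = + above k (lab v)

  level-remainder : ∀ k → (λ v → + lower k (lab v)) ≗ _⊖_ {S} ℓ (level k)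
  level-remainder k v = begin
    + lower k (lab v)                 ≡⟨ sum-minus-left (level k v) _ _ split ⟨
    + lab v ℤ.- level k v             ≡⟨ cong (ℤ._- level k v) (lab-correct v) ⟩
    ℓ v ℤ.- level k v                 ∎
    where
      split : level k v ℤ.+ + lower k (lab v) ≡ + lab v
      split = ≡.trans (≡.sym (ℤP.pos-+ (above k (lab v)) (lower k (lab v)))) (cong +_ (above+lower k (lab v)))

  -- Below the height some node lies above level k, so level k is nonzero.
  level-component : ∀ k → k ℕ.< height → StdComponent S ℓ (level k)
  level-component k k<height = zero-one , standard , remainder , nonzero
    where
      zero-one : ∀ v → level k v ≡ 0ℤ ⊎ level k v ≡ 1ℤ
      zero-one v with above-0-or-1 k (lab v)
      ... | inj₁ eq = inj₁ (cong +_ eq)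
      ... | inj₂ eq = inj₂ (cong +_ eq)

      standard : Standard S (level k)
      standard = (λ _ → +≤+ z≤n) , (λ a b ab → +≤+ (above-mono k (lab-mono a b ab)))

      remainder : Standard S (_⊖_ {S} ℓ (level k))
      remainder = Standard-resp S (level-remainder k)
        ((λ _ → +≤+ z≤n) , (λ a b ab → +≤+ (lower-mono k (lab-mono a b ab))))

      nonzero : ¬ (∀ v → level k v ≡ 0ℤ)
      nonzero all-zero = ℕP.<⇒≱ k<height
        (height-least (λ v → above≡0⇒≤ k (lab v) (ℤP.+-injective (all-zero v))))

  levels : ℕ → List (Labeling S)
  levels zero    = []
  levels (suc N) = level N ∷ levels N

  levels-components : ∀ N → N ℕ.≤ height → All (StdComponent S ℓ) (levels N)
  levels-components zero    _        = []
  levels-components (suc N) N<height = level-component N N<height ∷ levels-components N (ℕP.<⇒≤ N<height)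

  Σ-levels : ∀ N v → ΣL {S} (levels N) v ≡ + (N ⊓ lab v)
  Σ-levels zero    v = ≡.refl
  Σ-levels (suc N) v = begin
    level N v ℤ.+ ΣL {S} (levels N) v  ≡⟨ cong (λ s → level N v ℤ.+ s) (Σ-levels N v) ⟩
    + above N (lab v) ℤ.+ + (N ⊓ lab v) ≡⟨ ℤP.pos-+ (above N (lab v)) (N ⊓ lab v) ⟨
    + (above N (lab v) ℕ.+ N ⊓ lab v)   ≡⟨ cong +_ (above-step N (lab v)) ⟩
    + (suc N ⊓ lab v)                   ∎

  decomposition : ∃ λ D → StdDecomposition S ℓ D
  decomposition = levels height , levels-components height ℕP.≤-refl , λ v → begin
    ΣL {S} (levels height) v  ≡⟨ Σ-levels height v ⟩
    + (height ⊓ lab v)        ≡⟨ cong +_ (ℕP.m≥n⇒m⊓n≡n (lab≤height v)) ⟩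
    + lab v                   ≡⟨ lab-correct v ⟩
    ℓ v                       ∎

-- A standard decomposition containing H leaves a standard remainder:
-- ℓ ⊖ ΣH is the sum of the other components.
extension⇒standard : ∀ S (ℓ : Labeling S) (H : List (Labeling S)) →
  (∃ λ D → StdDecomposition S ℓ D × H ⊆ₘ D) → Standard S (_⊖_ {S} ℓ (ΣL {S} H))
extension⇒standard S ℓ H (D , (componentsD , ΣD≗ℓ) , R , D↭H++R) =
  Standard-resp S (λ v → ≡.sym (sum-minus-left (ΣL {S} H v) (ΣL {S} R v) (ℓ v) (ΣH+ΣR≡ℓ v)))
    (Standard-Σ S (components-standard S {ℓ} componentsR))
  where
    componentsR : All (StdComponent S ℓ) R
    componentsR = AllP.++⁻ʳ H (All-resp-↭ D↭H++R componentsD)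

    ΣH+ΣR≡ℓ : ∀ v → ΣL {S} H v ℤ.+ ΣL {S} R v ≡ ℓ v
    ΣH+ΣR≡ℓ v = ≡.trans (≡.sym (Σ-++ S H R v)) (≡.trans (≡.sym (Σ-↭ S D↭H++R v)) (ΣD≗ℓ v))

standard⇒extension : ∀ S (ℓ : Labeling S) (H : List (Labeling S)) → All (StdComponent S ℓ) H →
  Standard S (_⊖_ {S} ℓ (ΣL {S} H)) → ∃ λ D → StdDecomposition S ℓ D × H ⊆ₘ D
standard⇒extension S ℓ H componentsH std-rest
  with LevelDecomposition.decomposition S (_⊖_ {S} ℓ (ΣL {S} H)) std-rest
... | D′ , componentsD′ , ΣD′≗rest =
  H ++ D′ ,
  (AllP.++⁺ componentsH (All.map (component-lift S {ℓ} stdΣH) componentsD′) , Σ≗ℓ) ,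
  D′ , ↭-refl
  where
    stdΣH : Standard S (ΣL {S} H)
    stdΣH = Standard-Σ S (components-standard S {ℓ} componentsH)

    Σ≗ℓ : ∀ v → ΣL {S} (H ++ D′) v ≡ ℓ v
    Σ≗ℓ v = begin
      ΣL {S} (H ++ D′) v                        ≡⟨ Σ-++ S H D′ v ⟩
      ΣL {S} H v ℤ.+ ΣL {S} D′ v                ≡⟨ cong (λ s → ΣL {S} H v ℤ.+ s) (ΣD′≗rest v) ⟩
      ΣL {S} H v ℤ.+ (ℓ v ℤ.- ΣL {S} H v)       ≡⟨ plus-difference (ℓ v) (ΣL {S} H v) ⟩
      ℓ v                                       ∎

proposition2p9 : ((S : Skeleton) (ℓ : Labeling S) (H : List (Labeling S)) → All (StdComponent S ℓ) H → (∃ (λ D → StdDecomposition S ℓ D × H ⊆ₘ D)) ⇔ Standard S (_⊖_ {S} ℓ (ΣL {S} H)))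
    × ((S : Skeleton) (ℓ : Labeling S) → Standard S ℓ → ∃ (λ D → StdDecomposition S ℓ D))
proposition2p9 =
  (λ S ℓ H componentsH → mk⇔ (extension⇒standard S ℓ H) (standard⇒extension S ℓ H componentsH)) ,
  LevelDecomposition.decomposition
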